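{- Let $n\in\mathbb{N}$ with $n\ge3$. Then $\mathsf{g}_{\pm}(C_2\oplus C_{2n})\ge 2n+2$.
   Context: For a finite abelian group $G$ (written additively), $\exp(G)$ denotes its exponent and $C_m$ a cyclic group of order $m$. The plus-minus weighted Harborth constant $\mathsf{g}_{\pm}(G)$ is the smallest $\ell\in\mathbb{N}$ such that for every subset $S\subseteq G$ with $|S|\ge\ell$ there exist $\exp(G)$ distinct elements $g_1,\dots,g_{\exp(G)}\in S$ and signs $\varepsilon_i\in\{+1,-1\}$ with $\sum_i\varepsilon_ig_i=0$. -}

module Defs where

open import Data.Nat using (ℕ; zero; suc; _*_; _≤_)
open import Data.Fin using (Fin; toℕ) renaming (zero to fzero; suc to fsuc)
open import Data.Integer using (ℤ; +_; _+_; _◃_)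
open import Data.Integer.Divisibility using (_∣_)
open import Data.Sign using (Sign)
open import Data.Product using (_×_; Σ; ∃; proj₁; proj₂)
open import Data.List using (List; length)
open import Data.List.Membership.Propositional using (_∈_)
open import Data.List.Relation.Unary.Unique.Propositional using (Unique)
open import Relation.Binary.PropositionalEquality using (_≡_)
open import Function.Definitions using (Injective)

sumℤ : ∀ {k} → (Fin k → ℤ) → ℤ
sumℤ {zero}  f = + 0
sumℤ {suc k} f = f fzero + sumℤ (λ i → f (fsuc i))

C2⊕C2n : ℕ → Set
C2⊕C2n n = Fin 2 × Fin (2 * n)

-- exp(C₂ ⊕ C₂ₙ) = lcm(2, 2n) = 2n  (for n ≥ 1).
expC2⊕C2n : ℕ → ℕ
expC2⊕C2n n = 2 * n

SignedZeroSum : (n k : ℕ) → (Fin k → C2⊕C2n n) → (Fin k → Sign) → Set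
SignedZeroSum n k g ε =
  ((+ 2) ∣ sumℤ (λ i → ε i ◃ toℕ (proj₁ (g i))))
  × ((+ (2 * n)) ∣ sumℤ (λ i → ε i ◃ toℕ (proj₂ (g i))))

HarborthPM : (n ℓ : ℕ) → Set
HarborthPM n ℓ =
  (S : List (C2⊕C2n n)) → Unique S → ℓ ≤ length S →
  Σ (Fin (expC2⊕C2n n) → C2⊕C2n n) λ g →
    Injective _≡_ _≡_ g × (∀ i → g i ∈ S) ×
    ∃ λ (ε : Fin (expC2⊕C2n n) → Sign) → SignedZeroSum n (expC2⊕C2n n) g ε

IsGpm : (n g : ℕ) → Set
IsGpm n g = HarborthPM n g × (∀ ℓ → HarborthPM n ℓ → g ≤ ℓ)

-- Reduction modulo 2 in each coordinate maps C₂ ⊕ C₂ₙ onto C₂ ⊕ C₂ and forgets signs, so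
-- 2n distinct elements with a signed zero sum give a zero-sum sequence of even length over
-- C₂ ⊕ C₂. If no term is 0, the three nonzero classes then all occur an even number of times.
-- Let S have 2n + 1 elements, none in the class (0,0), with odd numbers m, m, r of elements in
-- the classes (0,1), (1,0), (1,1) (m = n, r = 1 for odd n; m = n - 1, r = 3 for even n).
-- Any 2n of them would use at most m - 1, m - 1, r - 1 elements of those classes, only 2n - 2.
module Submission where

open import Defs
open import Data.Nat
  using (ℕ; zero; suc; _+_; _*_; _≤_; _<_; _%_; NonZero; z≤n; s≤s; s≤s⁻¹; >-nonZero)
import Data.Nat.Properties as ℕP
open import Data.Nat.Divisibility using (_∣_; ∣m+n∣m⇒∣n; m∣m*n; ∣-trans; m%n≡0⇒n∣m; n∣m⇒m%n≡0)
open import Data.Nat.DivMod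
  using (_mod_; _divMod_; result; %-distribˡ-+; m%n%n≡m%n; [m+kn]%n≡m%n; m<n⇒m%n≡m)
open import Data.Nat.ListAction using (sum)
open import Data.Nat.ListAction.Properties using (sum-++)
import Data.Nat.Tactic.RingSolver as ℕ-Ring
open import Data.Integer as ℤ using (_◃_)
import Data.Integer.Properties as ℤP
import Data.Integer.Divisibility as ℤDiv
import Data.Integer.Divisibility.Signed as ℤ∣
import Data.Integer.Tactic.RingSolver as ℤ-Ring
open import Data.Sign using (Sign)
open import Data.Fin using (Fin; toℕ; punchIn; punchOut)
open import Data.Fin.Patterns using (0F; 1F)
import Data.Fin.Properties as FinP
open import Algebra.Properties.CommutativeMonoid.Sum ℕP.+-0-commutativeMonoid
  using (sum-remove; ∑-distrib-+; sum-cong-≗) renaming (sum to ∑)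
open import Data.Product using (_×_; _,_; proj₁; proj₂)
import Data.Product.Properties as ×P
open import Data.Bool using (if_then_else_)
open import Data.List using (List; []; _∷_; length; map; lookup; applyUpTo; _++_)
import Data.List.Properties as ListP
open import Data.List.Relation.Unary.All as All using (All)
import Data.List.Relation.Unary.All.Properties as AllP
open import Data.List.Relation.Unary.Any using (index)
open import Data.List.Relation.Unary.Any.Properties using (lookup-index)
open import Data.List.Relation.Unary.Unique.Propositional using (Unique)
import Data.List.Relation.Unary.Unique.Propositional.Properties as UniqueP
open import Data.List.Relation.Binary.Disjoint.Propositional using (Disjoint)
open import Data.List.Membership.Propositional using (_∈_)
open import Data.Empty using (⊥)
open import Function using (_∘_)
open import Function.Definitions using (Injective)
open import Relation.Nullary using (¬_; Dec; does; contradiction)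
open import Relation.Binary.PropositionalEquality

∑-const-1 : ∀ k → ∑ {k} (λ _ → 1) ≡ k
∑-const-1 zero    = refl
∑-const-1 (suc k) = cong suc (∑-const-1 k)

∑-split : ∀ {k} (f g h : Fin k → ℕ) → (∀ i → f i ≡ g i + h i) → ∑ f ≡ ∑ g + ∑ h
∑-split f g h f≡g+h = trans (sum-cong-≗ f≡g+h) (∑-distrib-+ g h)

∑-∘-injective-≤ : ∀ {a b} (h : Fin a → Fin b) → Injective _≡_ _≡_ h →
                  (w : Fin b → ℕ) → ∑ (w ∘ h) ≤ ∑ w
∑-∘-injective-≤ {zero}          h _     w = z≤n
∑-∘-injective-≤ {suc a} {zero}  h _     w = contradiction (h 0F) FinP.¬Fin0
∑-∘-injective-≤ {suc a} {suc b} h h-inj w = begin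
  w p + ∑ (w ∘ h ∘ Fin.suc)     ≡⟨ cong (w p +_) (sum-cong-≗ (cong w ∘ h≡punchIn-h′)) ⟩
  w p + ∑ (w ∘ punchIn p ∘ h′)  ≤⟨ ℕP.+-monoʳ-≤ (w p) (∑-∘-injective-≤ h′ h′-inj (w ∘ punchIn p)) ⟩
  w p + ∑ (w ∘ punchIn p)       ≡⟨ sum-remove w ⟨
  ∑ w                           ∎
  where
  open ℕP.≤-Reasoning
  p = h 0F
  p≢ : ∀ i → p ≢ h (Fin.suc i)
  p≢ i = FinP.0≢1+n ∘ h-inj
  h′ : Fin a → Fin b
  h′ i = punchOut (p≢ i)
  h≡punchIn-h′ : ∀ i → h (Fin.suc i) ≡ punchIn p (h′ i)
  h≡punchIn-h′ i = sym (FinP.punchIn-punchOut (p≢ i))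
  h′-inj : Injective _≡_ _≡_ h′
  h′-inj {i} {j} = FinP.suc-injective ∘ h-inj ∘ FinP.punchOut-injective (p≢ i) (p≢ j)

∑-lookup : ∀ {A : Set} (w : A → ℕ) (xs : List A) → ∑ (w ∘ lookup xs) ≡ sum (map w xs)
∑-lookup w []       = refl
∑-lookup w (x ∷ xs) = cong (w x +_) (∑-lookup w xs)

∑-members-≤ : ∀ {A : Set} {k} (xs : List A) (g : Fin k → A) → Injective _≡_ _≡_ g →
              (∀ i → g i ∈ xs) → (w : A → ℕ) → ∑ (w ∘ g) ≤ sum (map w xs)
∑-members-≤ xs g g-inj g∈xs w = begin
  ∑ (w ∘ g)              ≡⟨ sum-cong-≗ (cong w ∘ g≡lookup) ⟩
  ∑ (w ∘ lookup xs ∘ h)  ≤⟨ ∑-∘-injective-≤ h h-inj (w ∘ lookup xs) ⟩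
  ∑ (w ∘ lookup xs)      ≡⟨ ∑-lookup w xs ⟩
  sum (map w xs)         ∎
  where
  open ℕP.≤-Reasoning
  h = index ∘ g∈xs
  g≡lookup : ∀ i → g i ≡ lookup xs (h i)
  g≡lookup i = lookup-index (g∈xs i)
  h-inj : Injective _≡_ _≡_ h
  h-inj {i} {j} hi≡hj =
    g-inj (trans (g≡lookup i) (trans (cong (lookup xs) hi≡hj) (sym (g≡lookup j))))

%-distrib-∑ : ∀ {k} d .{{_ : NonZero d}} (v : Fin k → ℕ) → ∑ v % d ≡ ∑ (λ i → v i % d) % d
%-distrib-∑ {zero}  d v = refl
%-distrib-∑ {suc k} d v = begin
  (v 0F + ∑ v′) % d                ≡⟨ %-distribˡ-+ (v 0F) (∑ v′) d ⟩
  (v 0F % d + ∑ v′ % d) % d        ≡⟨ cong₂ (λ a b → (a + b) % d) (m%n%n≡m%n (v 0F) d)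
                                                                  (sym (%-distrib-∑ d v′)) ⟨
  (v 0F % d % d + ∑ v′%d % d) % d  ≡⟨ %-distribˡ-+ (v 0F % d) (∑ v′%d) d ⟨
  (v 0F % d + ∑ v′%d) % d          ∎
  where
  open ≡-Reasoning
  v′ v′%d : Fin k → ℕ
  v′ i = v (Fin.suc i)
  v′%d i = v′ i % d

∣∑⇒∣∑% : ∀ {k} d .{{_ : NonZero d}} (v : Fin k → ℕ) → d ∣ ∑ v → d ∣ ∑ (λ i → v i % d)
∣∑⇒∣∑% d v d∣∑v = m%n≡0⇒n∣m _ d (trans (sym (%-distrib-∑ d v)) (n∣m⇒m%n≡0 _ d d∣∑v))

-- Signs modulo 2

2∣n+s◃n : ∀ s n → (ℤ.+ 2) ℤ∣.∣ (ℤ.+ n ℤ.+ (s ◃ n))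
2∣n+s◃n Sign.+ n rewrite ℤP.+◃n≡+n n = ℤ∣.divides (ℤ.+ n) (double (ℤ.+ n))
  where
  double : ∀ x → x ℤ.+ x ≡ x ℤ.* ℤ.+ 2
  double = ℤ-Ring.solve-∀
2∣n+s◃n Sign.- n rewrite ℤP.-◃n≡-n n | ℤP.+-inverseʳ (ℤ.+ n) = ℤ∣.divides (ℤ.+ 0) refl

2∣∑+sumℤ◃ : ∀ {k} (ε : Fin k → Sign) (v : Fin k → ℕ) →
            (ℤ.+ 2) ℤ∣.∣ (ℤ.+ ∑ v ℤ.+ sumℤ (λ i → ε i ◃ v i))
2∣∑+sumℤ◃ {zero}  ε v = ℤ∣.divides (ℤ.+ 0) refl
2∣∑+sumℤ◃ {suc k} ε v =
  subst ((ℤ.+ 2) ℤ∣.∣_) (sym (interchange (ℤ.+ v 0F) (ℤ.+ ∑ (v ∘ Fin.suc)) (ε 0F ◃ v 0F) _))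
    (ℤ∣.∣m∣n⇒∣m+n (2∣n+s◃n (ε 0F) (v 0F)) (2∣∑+sumℤ◃ (ε ∘ Fin.suc) (v ∘ Fin.suc)))
  where
  interchange : ∀ a b c d → (a ℤ.+ b) ℤ.+ (c ℤ.+ d) ≡ (a ℤ.+ c) ℤ.+ (b ℤ.+ d)
  interchange = ℤ-Ring.solve-∀

2∣sumℤ◃⇒2∣∑ : ∀ {k} (ε : Fin k → Sign) (v : Fin k → ℕ) →
              (ℤ.+ 2) ℤDiv.∣ sumℤ (λ i → ε i ◃ v i) → 2 ∣ ∑ v
2∣sumℤ◃⇒2∣∑ ε v 2∣sumℤ = ℤ∣.∣⇒∣ᵤ 2∣+∑v
  where
  2∣+∑v : (ℤ.+ 2) ℤ∣.∣ ℤ.+ ∑ v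
  2∣+∑v = ℤ∣.∣m+n∣n⇒∣m {n = sumℤ (λ i → ε i ◃ v i)} (2∣∑+sumℤ◃ ε v) (ℤ∣.∣ᵤ⇒∣ 2∣sumℤ)

-- Multiplicities in C₂ ⊕ C₂

C₂⊕C₂ : Set
C₂⊕C₂ = Fin 2 × Fin 2

_≟_ : (p q : C₂⊕C₂) → Dec (p ≡ q)
_≟_ = ×P.≡-dec FinP._≟_ FinP._≟_

δ : C₂⊕C₂ → C₂⊕C₂ → ℕ
δ p q = if does (p ≟ q) then 1 else 0

δ-partition : ∀ c → δ c (0F , 0F) + δ c (0F , 1F) + δ c (1F , 0F) + δ c (1F , 1F) ≡ 1
δ-partition (0F , 0F) = refl
δ-partition (0F , 1F) = refl
δ-partition (1F , 0F) = refl
δ-partition (1F , 1F) = refl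

δ-proj₁ : ∀ c → toℕ (proj₁ c) ≡ δ c (1F , 0F) + δ c (1F , 1F)
δ-proj₁ (0F , 0F) = refl
δ-proj₁ (0F , 1F) = refl
δ-proj₁ (1F , 0F) = refl
δ-proj₁ (1F , 1F) = refl

δ-proj₂ : ∀ c → toℕ (proj₂ c) ≡ δ c (0F , 1F) + δ c (1F , 1F)
δ-proj₂ (0F , 0F) = refl
δ-proj₂ (0F , 1F) = refl
δ-proj₂ (1F , 0F) = refl
δ-proj₂ (1F , 1F) = refl

multiplicity : ∀ {k} → (Fin k → C₂⊕C₂) → C₂⊕C₂ → ℕ
multiplicity c q = ∑ (λ i → δ (c i) q)

module _ {k} (c : Fin k → C₂⊕C₂) where

  private
    #₀₀ #₀₁ #₁₀ #₁₁ : ℕ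
    #₀₀ = multiplicity c (0F , 0F)
    #₀₁ = multiplicity c (0F , 1F)
    #₁₀ = multiplicity c (1F , 0F)
    #₁₁ = multiplicity c (1F , 1F)

  multiplicities-sum : k ≡ #₀₀ + #₀₁ + #₁₀ + #₁₁
  multiplicities-sum = begin
    k                             ≡⟨ ∑-const-1 k ⟨
    ∑ {k} (λ _ → 1)               ≡⟨ ∑-split (λ _ → 1) (δ₀₀ +′ δ₀₁ +′ δ₁₀) δ₁₁ (sym ∘ δ-partition ∘ c) ⟩
    ∑ (δ₀₀ +′ δ₀₁ +′ δ₁₀) + #₁₁   ≡⟨ cong (_+ #₁₁) (∑-split _ (δ₀₀ +′ δ₀₁) δ₁₀ (λ _ → refl)) ⟩
    ∑ (δ₀₀ +′ δ₀₁) + #₁₀ + #₁₁    ≡⟨ cong (λ s → s + #₁₀ + #₁₁) (∑-split _ δ₀₀ δ₀₁ (λ _ → refl)) ⟩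
    #₀₀ + #₀₁ + #₁₀ + #₁₁         ∎
    where
    open ≡-Reasoning
    δ₀₀ δ₀₁ δ₁₀ δ₁₁ : Fin k → ℕ
    δ₀₀ i = δ (c i) (0F , 0F)
    δ₀₁ i = δ (c i) (0F , 1F)
    δ₁₀ i = δ (c i) (1F , 0F)
    δ₁₁ i = δ (c i) (1F , 1F)
    infixl 6 _+′_
    _+′_ : (f g : Fin k → ℕ) → Fin k → ℕ
    (f +′ g) i = f i + g i

  nonzero-multiplicities-sum : #₀₀ ≡ 0 → k ≡ #₀₁ + #₁₀ + #₁₁
  nonzero-multiplicities-sum #₀₀≡0 = trans multiplicities-sum (cong (λ m → m + #₀₁ + #₁₀ + #₁₁) #₀₀≡0)

  ∑-proj₁ : ∑ (toℕ ∘ proj₁ ∘ c) ≡ #₁₀ + #₁₁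
  ∑-proj₁ = ∑-split _ _ _ (δ-proj₁ ∘ c)

  ∑-proj₂ : ∑ (toℕ ∘ proj₂ ∘ c) ≡ #₀₁ + #₁₁
  ∑-proj₂ = ∑-split _ _ _ (δ-proj₂ ∘ c)

  zeroSum-multiplicities-even : 2 ∣ k → #₀₀ ≡ 0 → 2 ∣ ∑ (toℕ ∘ proj₁ ∘ c) → 2 ∣ ∑ (toℕ ∘ proj₂ ∘ c) →
                                2 ∣ #₀₁ × 2 ∣ #₁₀ × 2 ∣ #₁₁
  zeroSum-multiplicities-even 2∣k #₀₀≡0 2∣∑₁ 2∣∑₂ = 2∣#₀₁ , 2∣#₁₀ , ∣m+n∣m⇒∣n 2∣#₁₀+#₁₁ 2∣#₁₀
    where
    2∣#₀₁+#₁₀+#₁₁ = subst (2 ∣_) (nonzero-multiplicities-sum #₀₀≡0) 2∣k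
    2∣#₁₀+#₁₁ = subst (2 ∣_) ∑-proj₁ 2∣∑₁
    2∣#₀₁+#₁₁ = subst (2 ∣_) ∑-proj₂ 2∣∑₂
    rotate : ∀ x y z → x + y + z ≡ y + z + x
    rotate = ℕ-Ring.solve-∀
    swap : ∀ x y z → x + y + z ≡ x + z + y
    swap = ℕ-Ring.solve-∀
    2∣#₀₁ = ∣m+n∣m⇒∣n (subst (2 ∣_) (rotate #₀₁ #₁₀ #₁₁) 2∣#₀₁+#₁₀+#₁₁) 2∣#₁₀+#₁₁
    2∣#₁₀ = ∣m+n∣m⇒∣n (subst (2 ∣_) (swap #₀₁ #₁₀ #₁₁) 2∣#₀₁+#₁₀+#₁₁) 2∣#₀₁+#₁₁

parity : ∀ {m} → Fin 2 × Fin m → C₂⊕C₂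
parity (a , b) = a , toℕ b mod 2

signedZeroSum⇒parity-even : ∀ {n k} (g : Fin k → C2⊕C2n n) (ε : Fin k → Sign) →
  SignedZeroSum n k g ε → 2 ∣ ∑ (toℕ ∘ proj₁ ∘ parity ∘ g) × 2 ∣ ∑ (toℕ ∘ proj₂ ∘ parity ∘ g)
signedZeroSum⇒parity-even {n} {k} g ε (2∣∑a , 2n∣∑b) =
  2∣sumℤ◃⇒2∣∑ ε (toℕ ∘ proj₁ ∘ g) 2∣∑a ,
  subst (2 ∣_) (sum-cong-≗ {k} λ i → sym (FinP.toℕ-fromℕ< _))
    (∣∑⇒∣∑% 2 b (2∣sumℤ◃⇒2∣∑ ε b (∣-trans (m∣m*n {2} n) 2n∣∑b)))
  where
  b = toℕ ∘ proj₂ ∘ g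

-- The obstruction

count : ∀ {m} → C₂⊕C₂ → List (Fin 2 × Fin m) → ℕ
count q xs = sum (map (λ x → δ (parity x) q) xs)

multiplicity-≤-count : ∀ {m k} (xs : List (Fin 2 × Fin m)) (g : Fin k → Fin 2 × Fin m) →
  Injective _≡_ _≡_ g → (∀ i → g i ∈ xs) → ∀ q → multiplicity (parity ∘ g) q ≤ count q xs
multiplicity-≤-count xs g g-inj g∈xs q = ∑-members-≤ xs g g-inj g∈xs (λ x → δ (parity x) q)

even≤odd⇒< : ∀ {x m} → 2 ∣ x → ¬ 2 ∣ m → x ≤ m → x < m
even≤odd⇒< 2∣x 2∤m x≤m = ℕP.≤∧≢⇒< x≤m (λ { refl → 2∤m 2∣x })

<-sum-gap : ∀ {x y z a b c} → x < a → y < b → z < c → a + b + c ≤ suc (x + y + z) → ⊥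
<-sum-gap {x} {y} {z} x<a y<b z<c a+b+c≤ = ℕP.m+1+n≰m (suc (x + y + z)) (begin
  suc (x + y + z) + 2    ≡⟨ shift x y z ⟩
  suc x + suc y + suc z  ≤⟨ ℕP.+-mono-≤ (ℕP.+-mono-≤ x<a y<b) z<c ⟩
  _                      ≤⟨ a+b+c≤ ⟩
  suc (x + y + z)        ∎)
  where
  open ℕP.≤-Reasoning
  shift : ∀ x y z → suc (x + y + z) + 2 ≡ suc x + suc y + suc z
  shift = ℕ-Ring.solve-∀

record ParityObstruction (k : ℕ) {m} (S : List (Fin 2 × Fin m)) : Set where
  field
    no-00  : count (0F , 0F) S ≡ 0
    odd-01 : ¬ 2 ∣ count (0F , 1F) S
    odd-10 : ¬ 2 ∣ count (1F , 0F) S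
    odd-11 : ¬ 2 ∣ count (1F , 1F) S
    small  : count (0F , 1F) S + count (1F , 0F) S + count (1F , 1F) S ≤ suc k

ParityObstruction⇒¬SignedZeroSum : ∀ {n k} {S : List (C2⊕C2n n)} → 2 ∣ k → ParityObstruction k S →
  (g : Fin k → C2⊕C2n n) → Injective _≡_ _≡_ g → (∀ i → g i ∈ S) →
  (ε : Fin k → Sign) → ¬ SignedZeroSum n k g ε
ParityObstruction⇒¬SignedZeroSum {n} {S = S} 2∣k obstruction g g-inj g∈S ε zeroSum =
  let 2∣∑₁ , 2∣∑₂ = signedZeroSum⇒parity-even {n} g ε zeroSum
      2∣#₀₁ , 2∣#₁₀ , 2∣#₁₁ = zeroSum-multiplicities-even c 2∣k #₀₀≡0 2∣∑₁ 2∣∑₂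
  in <-sum-gap (even≤odd⇒< 2∣#₀₁ odd-01 (#≤count (0F , 1F)))
               (even≤odd⇒< 2∣#₁₀ odd-10 (#≤count (1F , 0F)))
               (even≤odd⇒< 2∣#₁₁ odd-11 (#≤count (1F , 1F)))
               (subst (λ t → _ ≤ suc t) (nonzero-multiplicities-sum c #₀₀≡0) small)
  where
  open ParityObstruction obstruction
  c = parity ∘ g
  #≤count = multiplicity-≤-count S g g-inj g∈S
  #₀₀≡0 : multiplicity c (0F , 0F) ≡ 0
  #₀₀≡0 = ℕP.n≤0⇒n≡0 (ℕP.≤-trans (#≤count (0F , 0F)) (ℕP.≤-reflexive no-00))

-- The witness set

count-++ : ∀ {m} q (xs ys : List (Fin 2 × Fin m)) → count q (xs ++ ys) ≡ count q xs + count q ys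
count-++ q xs ys = trans (cong sum (ListP.map-++ w xs ys)) (sum-++ (map w xs) (map w ys))
  where
  w = λ x → δ (parity x) q

count-fibre : ∀ {m p} q (xs : List (Fin 2 × Fin m)) → All (λ x → parity x ≡ p) xs →
              count q xs ≡ δ p q * length xs
count-fibre {p = p} q []       All.[]           = sym (ℕP.*-zeroʳ (δ p q))
count-fibre {p = p} q (x ∷ xs) (refl All.∷ pxs) =
  trans (cong (δ p q +_) (count-fibre q xs pxs)) (sym (ℕP.*-suc (δ p q) (length xs)))

disjoint-fibres : ∀ {A B : Set} {f : A → B} {p q : B} {xs ys : List A} → p ≢ q →
                  All (λ x → f x ≡ p) xs → All (λ y → f y ≡ q) ys → Disjoint xs ys
disjoint-fibres p≢q fxs≡p fys≡q (v∈xs , v∈ys) =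
  p≢q (trans (sym (All.lookup fxs≡p v∈xs)) (All.lookup fys≡q v∈ys))

2∤1+s*2 : ∀ s → ¬ 2 ∣ 1 + s * 2
2∤1+s*2 s 2∣1+s*2 =
  contradiction (trans (sym ([m+kn]%n≡m%n 1 s 2)) (n∣m⇒m%n≡0 _ 2 2∣1+s*2)) λ ()

record OddSplit (n : ℕ) : Set where
  field
    m r   : ℕ
    m≤n   : m ≤ n
    r≤n   : r ≤ n
    m-odd : ¬ 2 ∣ m
    r-odd : ¬ 2 ∣ r
    sum≡  : m + (m + r) ≡ suc (2 * n)

oddSplit : ∀ n → 3 ≤ n → OddSplit n
oddSplit n 3≤n with n divMod 2
... | result (suc q) 0F refl = record
  { m = 1 + q * 2 ; r = 3 ; m≤n = ℕP.n≤1+n _ ; r≤n = 3≤n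
  ; m-odd = 2∤1+s*2 q ; r-odd = 2∤1+s*2 1 ; sum≡ = identity q }
  where
  identity : ∀ q → 1 + q * 2 + (1 + q * 2 + 3) ≡ suc (2 * (2 + q * 2))
  identity = ℕ-Ring.solve-∀
... | result q 1F refl = record
  { m = 1 + q * 2 ; r = 1 ; m≤n = ℕP.≤-refl ; r≤n = s≤s z≤n
  ; m-odd = 2∤1+s*2 q ; r-odd = 2∤1+s*2 0 ; sum≡ = identity q }
  where
  identity : ∀ q → 1 + q * 2 + (1 + q * 2 + 1) ≡ suc (2 * (1 + q * 2))
  identity = ℕ-Ring.solve-∀

module WitnessSet (n : ℕ) .{{_ : NonZero n}} where

  private instance
    2n≢0 : NonZero (2 * n)
    2n≢0 = ℕP.m*n≢0 2 n

  element : C₂⊕C₂ → ℕ → C2⊕C2n n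
  element (a , r) j = a , (toℕ r + j * 2) mod (2 * n)

  block : C₂⊕C₂ → ℕ → List (C2⊕C2n n)
  block p = applyUpTo (element p)

  r+j*2<2n : ∀ {j} (r : Fin 2) → j < n → toℕ r + j * 2 < 2 * n
  r+j*2<2n {j} r j<n = begin-strict
    toℕ r + j * 2  <⟨ ℕP.+-monoˡ-< (j * 2) (FinP.toℕ<n r) ⟩
    2 + j * 2      ≤⟨ ℕP.*-monoˡ-≤ 2 j<n ⟩
    n * 2          ≡⟨ ℕP.*-comm n 2 ⟩
    2 * n          ∎
    where open ℕP.≤-Reasoning

  toℕ-element : ∀ {j} p → j < n → toℕ (proj₂ (element p j)) ≡ toℕ (proj₂ p) + j * 2
  toℕ-element (a , r) j<n = trans (FinP.toℕ-fromℕ< _) (m<n⇒m%n≡m (r+j*2<2n r j<n))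

  parity-element : ∀ {j} p → j < n → parity (element p j) ≡ p
  parity-element {j} (a , r) j<n = cong (a ,_) (FinP.toℕ-injective (begin
    toℕ (toℕ b mod 2)    ≡⟨ FinP.toℕ-fromℕ< _ ⟩
    toℕ b % 2            ≡⟨ cong (_% 2) (toℕ-element (a , r) j<n) ⟩
    (toℕ r + j * 2) % 2  ≡⟨ [m+kn]%n≡m%n (toℕ r) j 2 ⟩
    toℕ r % 2            ≡⟨ m<n⇒m%n≡m (FinP.toℕ<n r) ⟩
    toℕ r                ∎))
    where
    open ≡-Reasoning
    b = proj₂ (element (a , r) j)

  element-injective : ∀ {i j} p → i < n → j < n → element p i ≡ element p j → i ≡ j
  element-injective {i} {j} p@(a , r) i<n j<n eq =
    ℕP.*-cancelʳ-≡ i j 2 (ℕP.+-cancelˡ-≡ (toℕ r) _ _ (begin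
      toℕ r + i * 2                ≡⟨ toℕ-element p i<n ⟨
      toℕ (proj₂ (element p i))    ≡⟨ cong (toℕ ∘ proj₂) eq ⟩
      toℕ (proj₂ (element p j))    ≡⟨ toℕ-element p j<n ⟩
      toℕ r + j * 2                ∎))
    where open ≡-Reasoning

  block-unique : ∀ {m} p → m ≤ n → Unique (block p m)
  block-unique {m} p m≤n = UniqueP.applyUpTo⁺₁ (element p) m λ i<j j<m →
    ℕP.<⇒≢ i<j ∘ element-injective p (ℕP.<-≤-trans (ℕP.<-trans i<j j<m) m≤n) (ℕP.<-≤-trans j<m m≤n)

  block-parity : ∀ {m} p → m ≤ n → All (λ x → parity x ≡ p) (block p m)
  block-parity {m} p m≤n =
    AllP.applyUpTo⁺₁ (element p) m λ i<m → parity-element p (ℕP.<-≤-trans i<m m≤n)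

  count-block : ∀ {m} p q → m ≤ n → count q (block p m) ≡ δ p q * m
  count-block {m} p q m≤n = trans (count-fibre q (block p m) (block-parity p m≤n))
                                  (cong (δ p q *_) (ListP.length-applyUpTo _ m))

  module _ (split : OddSplit n) where
    open OddSplit split

    witness : List (C2⊕C2n n)
    witness = block (0F , 1F) m ++ block (1F , 0F) m ++ block (1F , 1F) r

    witness-unique : Unique witness
    witness-unique = UniqueP.++⁺ (block-unique _ m≤n)
      (UniqueP.++⁺ (block-unique _ m≤n) (block-unique _ r≤n)
        (disjoint-fibres (λ ()) (block-parity _ m≤n) (block-parity _ r≤n)))
      (disjoint-fibres {f = proj₁ ∘ parity} (λ ())
        (All.map (cong proj₁) (block-parity _ m≤n))
        (AllP.++⁺ (All.map (cong proj₁) (block-parity _ m≤n)) (All.map (cong proj₁) (block-parity _ r≤n))))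

    witness-length : length witness ≡ suc (2 * n)
    witness-length = begin
      length witness
        ≡⟨ ListP.length-++ (block (0F , 1F) m) ⟩
      length (block (0F , 1F) m) + length (block (1F , 0F) m ++ block (1F , 1F) r)
        ≡⟨ cong (length (block (0F , 1F) m) +_) (ListP.length-++ (block (1F , 0F) m)) ⟩
      length (block (0F , 1F) m) + (length (block (1F , 0F) m) + length (block (1F , 1F) r))
        ≡⟨ cong₂ _+_ (ListP.length-applyUpTo _ m)
                     (cong₂ _+_ (ListP.length-applyUpTo _ m) (ListP.length-applyUpTo _ r)) ⟩
      m + (m + r)
        ≡⟨ sum≡ ⟩
      suc (2 * n) ∎
      where open ≡-Reasoning

    count-witness : ∀ q →
      count q witness ≡ δ (0F , 1F) q * m + (δ (1F , 0F) q * m + δ (1F , 1F) q * r)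
    count-witness q = begin
      count q witness
        ≡⟨ count-++ q (block (0F , 1F) m) _ ⟩
      count q (block (0F , 1F) m) + count q (block (1F , 0F) m ++ block (1F , 1F) r)
        ≡⟨ cong (count q (block (0F , 1F) m) +_) (count-++ q (block (1F , 0F) m) _) ⟩
      count q (block (0F , 1F) m) + (count q (block (1F , 0F) m) + count q (block (1F , 1F) r))
        ≡⟨ cong₂ _+_ (count-block _ q m≤n) (cong₂ _+_ (count-block _ q m≤n) (count-block _ q r≤n)) ⟩
      δ (0F , 1F) q * m + (δ (1F , 0F) q * m + δ (1F , 1F) q * r) ∎
      where open ≡-Reasoning

    witness-obstruction : ParityObstruction (2 * n) witness
    witness-obstruction = record
      { no-00  = count-witness (0F , 0F)
      ; odd-01 = m-odd ∘ subst (2 ∣_) #₀₁≡m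
      ; odd-10 = m-odd ∘ subst (2 ∣_) #₁₀≡m
      ; odd-11 = r-odd ∘ subst (2 ∣_) #₁₁≡r
      ; small  = ℕP.≤-reflexive
          (trans (cong₂ _+_ (cong₂ _+_ #₀₁≡m #₁₀≡m) #₁₁≡r) (trans (ℕP.+-assoc m m r) sum≡))
      }
      where
      #₀₁≡m : count (0F , 1F) witness ≡ m
      #₀₁≡m = trans (count-witness _) (trans (ℕP.+-identityʳ _) (ℕP.+-identityʳ m))
      #₁₀≡m : count (1F , 0F) witness ≡ m
      #₁₀≡m = trans (count-witness _) (trans (ℕP.+-identityʳ _) (ℕP.+-identityʳ m))
      #₁₁≡r : count (1F , 1F) witness ≡ r
      #₁₁≡r = trans (count-witness _) (ℕP.+-identityʳ r)

lemma5p1 : (n : ℕ) → 3 ≤ n → (g : ℕ) → IsGpm n g → 2 * n + 2 ≤ g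
lemma5p1 n 3≤n g (harborth , _) = ℕP.≮⇒≥ λ g<2n+2 →
  let h , h-inj , h∈S , ε , zeroSum = harborth S (witness-unique split) (g≤|S| g<2n+2)
  in ParityObstruction⇒¬SignedZeroSum {n} (m∣m*n n) (witness-obstruction split) h h-inj h∈S ε zeroSum
  where
  instance
    n≢0 : NonZero n
    n≢0 = >-nonZero (ℕP.≤-trans (s≤s z≤n) 3≤n)
  open WitnessSet n
  split = oddSplit n 3≤n
  S = witness split
  g≤|S| : g < 2 * n + 2 → g ≤ length S
  g≤|S| g<2n+2 = subst (g ≤_) (sym (witness-length split))
                       (s≤s⁻¹ (subst (suc g ≤_) (ℕP.+-comm (2 * n) 2) g<2n+2))
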